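{- Let $\sigma$ be an instance of $k$-MPMD on an $H$-metric $d_H$ with positive integer parameter $\gamma\le k-1$, with request set $V$. Let $\mathcal M$ be any perfect $k$-way matching of $V$ and let $M=\{\{u,v\}: u\ne v,\ \exists F\in\mathcal M \text{ with } u,v\in F\}$. Then the characteristic vector $x=\mathbb 1_M\in\{0,1\}^E$ is a feasible solution of the linear program $(\mathcal P')$. Furthermore, $\mathcal P'(\sigma)\le\mathcal{OPT}(\sigma)$.
   Context: $H$-metric: for a multiset $S$ on $\chi$, $elem(S)$ is its set of distinct elements. $d_H:\chi^k\to[0,\infty)$ is an $H$-metric with parameter $\gamma$ if: ($\Pi$) it is invariant under permuting its arguments; ($O_D$) $d_H(p_1,\ldots,p_k)=0$ iff $p_1=\cdots=p_k$; ($\Delta_H$) for all $p_1,\ldots,p_k,a\in\chi$ and $i\in\{1,\ldots,k\}$, $d_H(p_1,\ldots,p_k)\le d_H(p_1,\ldots,p_i,a,\ldots,a)+d_H(a,\ldots,a,p_{i+1},\ldots,p_k)$ (with $a$ repeated $k-i$ resp. $i$ times); ($\mathcal S_H$) $d_H(p_1,\ldots,p_k)\le d_H(p'_1,\ldots,p'_k)$ whenever $elem(\{p_i\})\subset elem(\{p'_i\})$ properly, and $d_H(p_1,\ldots,p_k)\le \gamma\, d_H(p'_1,\ldots,p'_k)$ whenever $elem(\{p_i\})= elem(\{p'_i\})$. $k$-MPMD ($k\ge2$): an instance $\sigma=(V,\mathrm{atime},\mathrm{pos})$ consists of requests $V=\{u_1,\ldots,u_m\}$ ($m$ a multiple of $k$),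 arrival times $\mathrm{atime}:V\to\mathbb R_{\ge0}$ with $\mathrm{atime}(u_1)\le\cdots\le\mathrm{atime}(u_m)$, and positions $\mathrm{pos}:V\to\chi$. A perfect $k$-way matching is a partition of $V$ into sets of size $k$. For a $k$-set $F=\{v_1,\dots,v_k\}$, $\mathrm{opt\text{ - }cost}(F):=d_H(\mathrm{pos}(v_1),\ldots,\mathrm{pos}(v_k))+\sum_{i}(\max_j\mathrm{atime}(v_j)-\mathrm{atime}(v_i))$, and $\mathcal{OPT}(\sigma)$ is the minimum over perfect $k$-way matchings $\mathcal M$ of $\sum_{F\in\mathcal M}\mathrm{opt\text{ - }cost}(F)$ (the offline optimum). LP: $E$ is the set of unordered pairs $\{u,v\}$ of distinct requests in $V$. For $p,q\in\chi$, $d(p,q):=d_H(p,q,\ldots,q)+d_H(q,p,\ldots,p)$; for $e=\{u,v\}\in E$, $\mathrm{opt\text{ - }cost}(e):=d(\mathrm{pos}(u),\mathrm{pos}(v))+|\mathrm{atime}(u)-\mathrm{atime}(v)|$. For $S\subseteq V$, $\mathrm{sur}(S):=|S|\bmod k$ and $\delta(S)$ is the set of pairs in $E$ with exactly one endpoint in $S$. $(\mathcal P')$ is: minimize $\sum_{e\in E}\frac{1}{\gamma k^2}\mathrm{opt\text{ - }cost}(e)x_e$ subject to $\sum_{e\in\delta(S)}x_e\ge\mathrm{sur}(S)(k-\mathrm{sur}(S))$ for all $S\subseteq V$ and $x_e\ge0$ for all $e\in E$. $\mathcal P'(\sigma)$ denotes its optimal value. -}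

module Defs where

open import Level using (0ℓ)
open import Data.Bool using (Bool; true; false; if_then_else_; _xor_)
open import Data.Nat as ℕ using (ℕ; zero; suc; _∸_; NonZero; _<ᵇ_; _≡ᵇ_)
open import Data.Nat.DivMod using (_%_)
open import Data.Fin as Fin using (Fin; toℕ)
open import Data.Fin.Subset using (Subset; ∣_∣)
open import Data.Fin.Permutation using (Permutation′; _⟨$⟩ʳ_)
open import Data.Vec using (lookup)
open import Data.List using (List; []; _∷_; map; allFin)
open import Data.Product using (_×_; _,_; proj₁; ∃; Σ)
open import Data.Sum using (_⊎_; inj₁; inj₂)
open import Function.Bundles using (_↔_; Inverse)
open import Relation.Binary.Core using (Rel)
open import Relation.Binary.Structures using (IsTotalOrder)
open import Relation.Binary.PropositionalEquality using (_≡_)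
open import Relation.Nullary using (¬_)
open import Relation.Nullary.Decidable using (⌊_⌋)
open import Algebra.Core using (Op₁; Op₂)
open import Algebra.Structures using (IsCommutativeRing)

-- An ordered field (stands in for ℝ; ℝ is an instance).

record OrderedField : Set₁ where
  infixl 6 _+_ _-_
  infixl 7 _*_
  infix 4 _≤_ _<_
  field
    Carrier : Set
    _+_ _*_ : Op₂ Carrier
    -_ : Op₁ Carrier
    0# 1# : Carrier
    _≤_ : Rel Carrier 0ℓ
    inv : Carrier → Carrier
    isCommutativeRing : IsCommutativeRing _≡_ _+_ _*_ -_ 0# 1#
    isTotalOrder : IsTotalOrder _≡_ _≤_
    +-monoˡ-≤ : ∀ {x y} z → x ≤ y → x + z ≤ y + z
    0≤* : ∀ {x y} → 0# ≤ x → 0# ≤ y → 0# ≤ x * y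
    0≢1 : ¬ (0# ≡ 1#)
    inv-r : ∀ x → ¬ (x ≡ 0#) → x * inv x ≡ 1#

  _-_ : Op₂ Carrier
  x - y = x + (- y)

  _<_ : Rel Carrier 0ℓ
  x < y = (x ≤ y) × ¬ (x ≡ y)

  fromℕ : ℕ → Carrier
  fromℕ zero = 0#
  fromℕ (suc n) = 1# + fromℕ n

  max : Op₂ Carrier
  max x y with IsTotalOrder.total isTotalOrder x y
  ... | inj₁ _ = y
  ... | inj₂ _ = x

  abs : Carrier → Carrier
  abs x = max x (- x)

  maxList : List Carrier → Carrier
  maxList [] = 0#
  maxList (x ∷ []) = x
  maxList (x ∷ y ∷ xs) = max x (maxList (y ∷ xs))

  sumFin : (n : ℕ) → (Fin n → Carrier) → Carrier
  sumFin zero f = 0#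
  sumFin (suc n) f = f Fin.zero + sumFin n (λ i → f (Fin.suc i))

module HMetric (F : OrderedField) {χ : Set} (k : ℕ) where
  open OrderedField F

  _∈elem_ : χ → (Fin k → χ) → Set
  x ∈elem p = ∃ λ j → p j ≡ x

  _⊆elem_ : (Fin k → χ) → (Fin k → χ) → Set
  p ⊆elem p' = ∀ x → x ∈elem p → x ∈elem p'

  leftPart : (Fin k → χ) → χ → ℕ → Fin k → χ
  leftPart p a i j = if toℕ j <ᵇ i then p j else a

  rightPart : (Fin k → χ) → χ → ℕ → Fin k → χ
  rightPart p a i j = if toℕ j <ᵇ i then a else p j

  record IsHMetric (γ : ℕ) (dH : (Fin k → χ) → Carrier) : Set where
    field
      nonneg : ∀ p → 0# ≤ dH p
      perm-inv : ∀ p (π : Permutation′ k) → dH (λ j → p (π ⟨$⟩ʳ j)) ≡ dH p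
      zero⇒const : ∀ p → dH p ≡ 0# → ∀ i j → p i ≡ p j
      const⇒zero : ∀ p → (∀ i j → p i ≡ p j) → dH p ≡ 0#
      triangle : ∀ p a (i : ℕ) → 1 ℕ.≤ i → i ℕ.≤ k →
                 dH p ≤ dH (leftPart p a i) + dH (rightPart p a i)
      mono-proper : ∀ p p' → p ⊆elem p' → ¬ (p' ⊆elem p) → dH p ≤ dH p'
      mono-equal : ∀ p p' → p ⊆elem p' → p' ⊆elem p → dH p ≤ fromℕ γ * dH p'

-- A perfect k-way matching of V = Fin m, given as an enumeration
-- Fin n × Fin k ↔ Fin m : block F consists of the k requests φ(F,1..k).
PerfectMatching : (m k n : ℕ) → Set
PerfectMatching m k n = (Fin n × Fin k) ↔ Fin m

module MPMD (F : OrderedField) {χ : Set} (k γ : ℕ) .{{_ : NonZero k}}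
            (dH : (Fin k → χ) → OrderedField.Carrier F)
            (m : ℕ) (atime : Fin m → OrderedField.Carrier F) (pos : Fin m → χ) where
  open OrderedField F

  blockCost : ∀ {n} → PerfectMatching m k n → Fin n → Carrier
  blockCost φ B =
    dH (λ i → pos (to (B , i)))
    + sumFin k (λ i → maxList (map (λ j → atime (to (B , j))) (allFin k))
                      - atime (to (B , i)))
    where open Inverse φ

  matchingCost : ∀ {n} → PerfectMatching m k n → Carrier
  matchingCost {n} φ = sumFin n (blockCost φ)

  firstThenRest : χ → χ → Fin k → χ
  firstThenRest p q j = if toℕ j ≡ᵇ 0 then p else q

  d : χ → χ → Carrier
  d p q = dH (firstThenRest p q) + dH (firstThenRest q p)

  edgeCost : Fin m → Fin m → Carrier
  edgeCost u v = d (pos u) (pos v) + abs (atime u - atime v)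

  -- E = unordered pairs {u,v}, u ≠ v, represented by u < v.
  -- A vector in ℝ^E is a function x : Fin m → Fin m → Carrier read on u < v.
  sumE : (Fin m → Fin m → Carrier) → Carrier
  sumE g = sumFin m (λ u → sumFin m (λ v → if toℕ u <ᵇ toℕ v then g u v else 0#))

  objective : (Fin m → Fin m → Carrier) → Carrier
  objective x = sumE (λ u v → inv (fromℕ (γ ℕ.* k ℕ.* k)) * edgeCost u v * x u v)

  sur : Subset m → ℕ
  sur S = ∣ S ∣ % k

  sumδ : Subset m → (Fin m → Fin m → Carrier) → Carrier
  sumδ S x = sumE (λ u v → if lookup S u xor lookup S v then x u v else 0#)

  Feasible : (Fin m → Fin m → Carrier) → Set
  Feasible x = (∀ (S : Subset m) → fromℕ (sur S ℕ.* (k ∸ sur S)) ≤ sumδ S x)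
             × (∀ (u v : Fin m) → toℕ u ℕ.< toℕ v → 0# ≤ x u v)

  -- "P'(σ) ≤ c", i.e. inf { objective x | x feasible } ≤ c
  LPValue≤ : Carrier → Set
  LPValue≤ c = ∀ ε → 0# < ε → Σ (Fin m → Fin m → Carrier) λ x → Feasible x × objective x < c + ε

  indicator : ∀ {n} → PerfectMatching m k n → Fin m → Fin m → Carrier
  indicator φ u v = if ⌊ proj₁ (from u) Fin.≟ proj₁ (from v) ⌋ then 1# else 0#
    where open Inverse φ

-- A set S of requests meeting block B of the matching in s_B requests separates exactly
-- Σ_B s_B (k − s_B) matched pairs, and r ↦ r (k − r) is subadditive modulo k, so at least
-- sur(S) (k − sur(S)) of them: this is feasibility.  Inside a block every pair has
-- d(u, v) ≤ 2γ d_H(block) by the monotonicity axioms of the H-metric, and |atime u − atime v|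
-- is at most twice the block's total waiting time.  Summing over the k² ordered pairs of each
-- block counts every edge of M twice, so after scaling by 1/(γk²) the objective is at most the
-- cost of the matching.

module Submission where

open import Level using (0ℓ)
open import Algebra.Bundles using (CommutativeSemiring; CommutativeRing)
open import Data.Bool using (Bool; true; false; if_then_else_; not; _xor_)
open import Data.Bool.Properties using (xor-comm; xor-same)
open import Data.Empty using (⊥-elim)
open import Data.Fin as Fin using (Fin; toℕ; _↑ˡ_; _↑ʳ_; combine) renaming (_≤_ to _≤ᶠ_)
open import Data.Fin.Properties using (_≟_; *↔×; remQuot-combine; <-cmp; sequence)
open import Data.Fin.Subset using (Subset; ∣_∣)
open import Data.List using ([]; _∷_; map; allFin)
open import Data.List.Membership.Propositional using (_∈_)
open import Data.List.Membership.Propositional.Properties using (∈-map⁺; ∈-allFin)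
open import Data.List.Relation.Unary.Any using (here; there)
import Data.Nat.Properties as ℕ
open import Data.Nat as ℕ using (ℕ; zero; suc; _∸_; _<ᵇ_; _≡ᵇ_; NonZero; >-nonZero⁻¹)
open import Data.Nat.DivMod using (_%_)
open import Data.Nat.Divisibility using (_∣_)
open import Data.Product using (_×_; _,_; proj₁)
open import Data.Sum using (inj₁; inj₂)
open import Data.Vec as Vec using (lookup)
open import Data.Vec.Functional using (Vector)
open import Effect.Monad using (RawMonad)
open import Function.Base using (_∘_; flip)
open import Function.Bundles using (_↔_; Inverse)
open import Function.Construct.Composition using (_↔-∘_)
open import Relation.Binary.Bundles using (Poset)
open import Relation.Binary.Definitions using (tri<; tri≈; tri>)
open import Relation.Binary.PropositionalEquality as ≡ using (_≡_; _≢_; cong; cong₂; subst; subst₂)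
open import Relation.Binary.Structures using (IsTotalOrder)
open import Relation.Nullary.Decidable
  using (Dec; yes; no; ⌊_⌋; ⌊⌋-map′; isYes≗does; dec-true; dec-false; T?)
open import Relation.Nullary.Negation using (¬_; contradiction; contraposition; ¬¬-Monad; ¬¬-map)
import Relation.Binary.Reasoning.PartialOrder
open import Defs

<ᵇ-true : ∀ {m n} → m ℕ.< n → (m <ᵇ n) ≡ true
<ᵇ-true m<n = dec-true (T? _) (ℕ.<⇒<ᵇ m<n)

<ᵇ-false : ∀ {m n} → ¬ m ℕ.< n → (m <ᵇ n) ≡ false
<ᵇ-false {m} {n} m≮n = dec-false (T? _) (contraposition (ℕ.<ᵇ⇒< m n) m≮n)

⌊⌋-true : ∀ {a} {A : Set a} (a? : Dec A) → A → ⌊ a? ⌋ ≡ true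
⌊⌋-true a? a = ≡.trans (isYes≗does a?) (dec-true a? a)

⌊⌋-false : ∀ {a} {A : Set a} (a? : Dec A) → ¬ A → ⌊ a? ⌋ ≡ false
⌊⌋-false a? ¬a = ≡.trans (isYes≗does a?) (dec-false a? ¬a)

⌊⌋-≟-sym : ∀ {n} (i j : Fin n) → ⌊ i ≟ j ⌋ ≡ ⌊ j ≟ i ⌋
⌊⌋-≟-sym i j with i ≟ j
... | yes i≡j = ≡.sym (⌊⌋-true (j ≟ i) (≡.sym i≡j))
... | no  i≢j = ≡.sym (⌊⌋-false (j ≟ i) (i≢j ∘ ≡.sym))

module _ {m n k} (φ : (Fin n × Fin k) ↔ Fin m) where
  open Inverse φ

  block : Fin m → Fin n
  block u = proj₁ (from u)

  sameBlock : Fin m → Fin m → Bool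
  sameBlock u v = ⌊ block u ≟ block v ⌋

  block-to : ∀ B i → block (to (B , i)) ≡ B
  block-to B i = cong proj₁ (inverseʳ ≡.refl)

  sameBlock-sym : ∀ u v → sameBlock u v ≡ sameBlock v u
  sameBlock-sym u v = ⌊⌋-≟-sym (block u) (block v)

  sameBlock-refl : ∀ u → sameBlock u u ≡ true
  sameBlock-refl u = ⌊⌋-true (block u ≟ block u) ≡.refl

module FiniteSums {c ℓ} (R : CommutativeSemiring c ℓ) where

  open CommutativeSemiring R
  open import Algebra.Properties.Semiring.Sum semiring public
  open import Relation.Binary.Reasoning.Setoid setoid

  ⟦_⟧ : Bool → Carrier
  ⟦ b ⟧ = if b then 1# else 0#

  *-⟦⟧ : ∀ x b → x * ⟦ b ⟧ ≈ (if b then x else 0#)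
  *-⟦⟧ x true  = *-identityʳ x
  *-⟦⟧ x false = zeroʳ x

  ∑-if : ∀ {n} b (f : Vector Carrier n) →
         ∑[ i < n ] (if b then f i else 0#) ≈ (if b then sum f else 0#)
  ∑-if     true  f = refl
  ∑-if {n} false f = sum-replicate-zero n

  ∑-select : ∀ {n} (i : Fin n) (f : Vector Carrier n) →
             ∑[ j < n ] (if ⌊ i ≟ j ⌋ then f j else 0#) ≈ f i
  ∑-select {suc n} Fin.zero    f = trans (+-congˡ (sum-replicate-zero n)) (+-identityʳ _)
  ∑-select {suc n} (Fin.suc i) f = begin
    0# + ∑[ j < n ] (if ⌊ Fin.suc i ≟ Fin.suc j ⌋ then f (Fin.suc j) else 0#)
      ≈⟨ +-identityˡ _ ⟩
    ∑[ j < n ] (if ⌊ Fin.suc i ≟ Fin.suc j ⌋ then f (Fin.suc j) else 0#)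
      ≡⟨ sum-cong-≗ (λ j →
           ≡.cong (λ b → if b then f (Fin.suc j) else 0#) (⌊⌋-map′ _ _ (i ≟ j))) ⟩
    ∑[ j < n ] (if ⌊ i ≟ j ⌋ then f (Fin.suc j) else 0#)
      ≈⟨ ∑-select i (f ∘ Fin.suc) ⟩
    f (Fin.suc i) ∎

  ∑-splitAt : ∀ a {b} (f : Vector Carrier (a ℕ.+ b)) →
        sum f ≈ ∑[ i < a ] f (i ↑ˡ b) + ∑[ j < b ] f (a ↑ʳ j)
  ∑-splitAt zero    f = sym (+-identityˡ _)
  ∑-splitAt (suc a) f = trans (+-congˡ (∑-splitAt a (f ∘ Fin.suc))) (sym (+-assoc _ _ _))

  ∑-combine : ∀ n {k} (f : Vector Carrier (n ℕ.* k)) →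
              sum f ≈ ∑[ B < n ] ∑[ i < k ] f (combine B i)
  ∑-combine zero    f = refl
  ∑-combine (suc n) {k} f = trans (∑-splitAt k f) (+-congˡ (∑-combine n (f ∘ (k ↑ʳ_))))

  module _ {m n k} (φ : (Fin n × Fin k) ↔ Fin m) where
    open Inverse φ

    ∑-blocks : (f : Vector Carrier m) → sum f ≈ ∑[ B < n ] ∑[ i < k ] f (to (B , i))
    ∑-blocks f = begin
      sum f
        ≈⟨ ∑-permute f (φ ↔-∘ *↔×) ⟩
      ∑[ p < n ℕ.* k ] f (to (Fin.remQuot k p))
        ≈⟨ ∑-combine n _ ⟩
      ∑[ B < n ] ∑[ i < k ] f (to (Fin.remQuot k (combine B i)))
        ≡⟨ sum-cong-≗ (λ B → sum-cong-≗ (λ i → ≡.cong (f ∘ to) (remQuot-combine B i))) ⟩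
      ∑[ B < n ] ∑[ i < k ] f (to (B , i)) ∎

    ∑-sameBlock : ∀ u (h : Vector Carrier m) →
                  ∑[ v < m ] (if sameBlock φ u v then h v else 0#) ≈ ∑[ j < k ] h (to (block φ u , j))
    ∑-sameBlock u h = begin
      ∑[ v < m ] (if sameBlock φ u v then h v else 0#)
        ≈⟨ ∑-blocks _ ⟩
      ∑[ B < n ] ∑[ j < k ] (if sameBlock φ u (to (B , j)) then h (to (B , j)) else 0#)
        ≡⟨ sum-cong-≗ (λ B → sum-cong-≗ (λ j →
             ≡.cong (λ B′ → if ⌊ block φ u ≟ B′ ⌋ then h (to (B , j)) else 0#)
                    (block-to φ B j))) ⟩
      ∑[ B < n ] ∑[ j < k ] (if ⌊ block φ u ≟ B ⌋ then h (to (B , j)) else 0#)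
        ≈⟨ sum-cong-≋ (λ B → ∑-if ⌊ block φ u ≟ B ⌋ (λ j → h (to (B , j)))) ⟩
      ∑[ B < n ] (if ⌊ block φ u ≟ B ⌋ then ∑[ j < k ] h (to (B , j)) else 0#)
        ≈⟨ ∑-select (block φ u) _ ⟩
      ∑[ j < k ] h (to (block φ u , j)) ∎

    ∑∑-sameBlock : (h : Fin m → Fin m → Carrier) →
                   ∑[ u < m ] ∑[ v < m ] (if sameBlock φ u v then h u v else 0#)
                   ≈ ∑[ B < n ] ∑[ i < k ] ∑[ j < k ] h (to (B , i)) (to (B , j))
    ∑∑-sameBlock h = begin
      ∑[ u < m ] ∑[ v < m ] (if sameBlock φ u v then h u v else 0#)
        ≈⟨ sum-cong-≋ (λ u → ∑-sameBlock u (h u)) ⟩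
      ∑[ u < m ] ∑[ j < k ] h u (to (block φ u , j))
        ≈⟨ ∑-blocks _ ⟩
      ∑[ B < n ] ∑[ i < k ] ∑[ j < k ] h (to (B , i)) (to (block φ (to (B , i)) , j))
        ≡⟨ sum-cong-≗ (λ B → sum-cong-≗ (λ i → sum-cong-≗ (λ j →
             ≡.cong (λ B′ → h (to (B , i)) (to (B′ , j))) (block-to φ B i)))) ⟩
      ∑[ B < n ] ∑[ i < k ] ∑[ j < k ] h (to (B , i)) (to (B , j)) ∎

  ∑< : ∀ {m} → (Fin m → Fin m → Carrier) → Carrier
  ∑< {m} g = ∑[ u < m ] ∑[ v < m ] (if toℕ u <ᵇ toℕ v then g u v else 0#)

  split-by-order : ∀ {m} (g : Fin m → Fin m → Carrier) u v →
    g u v ≈ (if toℕ u <ᵇ toℕ v then g u v else 0#)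
            + ((if toℕ v <ᵇ toℕ u then g u v else 0#) + (if ⌊ u ≟ v ⌋ then g u v else 0#))
  split-by-order g u v with <-cmp u v
  ... | tri< u<v u≢v u≯v rewrite <ᵇ-true u<v | <ᵇ-false u≯v | ⌊⌋-false (u ≟ v) u≢v =
    sym (trans (+-congˡ (+-identityˡ 0#)) (+-identityʳ _))
  ... | tri> u≮v u≢v u>v rewrite <ᵇ-false u≮v | <ᵇ-true u>v | ⌊⌋-false (u ≟ v) u≢v =
    sym (trans (+-identityˡ _) (+-identityʳ _))
  ... | tri≈ u≮v ≡.refl _ rewrite <ᵇ-false u≮v | ⌊⌋-true (u ≟ u) ≡.refl =
    sym (trans (+-identityˡ _) (+-identityˡ _))

  ∑∑-split : ∀ {m} (g : Fin m → Fin m → Carrier) →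
             ∑[ u < m ] ∑[ v < m ] g u v ≈ ∑< g + (∑< (flip g) + ∑[ u < m ] g u u)
  ∑∑-split {m} g = begin
    ∑[ u < m ] ∑[ v < m ] g u v
      ≈⟨ sum-cong-≋ (λ u → sum-cong-≋ (split-by-order g u)) ⟩
    ∑[ u < m ] ∑[ v < m ] (lt u v + (gt u v + eq u v))
      ≈⟨ sum-cong-≋ (λ u → trans (∑-distrib-+ (lt u) _) (+-congˡ (∑-distrib-+ (gt u) (eq u)))) ⟩
    ∑[ u < m ] (∑[ v < m ] lt u v + (∑[ v < m ] gt u v + ∑[ v < m ] eq u v))
      ≈⟨ trans (∑-distrib-+ (λ u → sum (lt u)) _)
               (+-congˡ (∑-distrib-+ (λ u → sum (gt u)) (λ u → sum (eq u)))) ⟩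
    ∑< g + (∑[ u < m ] ∑[ v < m ] gt u v + ∑[ u < m ] ∑[ v < m ] eq u v)
      ≈⟨ +-congˡ (+-cong (∑-comm gt) (sum-cong-≋ (λ u → ∑-select u (g u)))) ⟩
    ∑< g + (∑< (flip g) + ∑[ u < m ] g u u) ∎
    where
    lt gt eq : Fin m → Fin m → Carrier
    lt u v = if toℕ u <ᵇ toℕ v then g u v else 0#
    gt u v = if toℕ v <ᵇ toℕ u then g u v else 0#
    eq u v = if ⌊ u ≟ v ⌋ then g u v else 0#

  ∑∑-split-sym : ∀ {m} (g : Fin m → Fin m → Carrier) → (∀ u v → g v u ≈ g u v) →
                 ∑[ u < m ] ∑[ v < m ] g u v ≈ ∑< g + (∑< g + ∑[ u < m ] g u u)
  ∑∑-split-sym g g-sym = trans (∑∑-split g)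
    (+-congˡ (+-congʳ (sum-cong-≋ (λ u → sum-cong-≋ (λ v →
      if-cong (toℕ u <ᵇ toℕ v) (g-sym u v))))))
    where
    if-cong : ∀ b {x y} → x ≈ y → (if b then x else 0#) ≈ (if b then y else 0#)
    if-cong true  x≈y = x≈y
    if-cong false _   = refl

  count : ∀ {n} → Vector Bool n → Carrier
  count a = ∑[ i < _ ] ⟦ a i ⟧

  ∑∑-xor : ∀ {n} (a : Vector Bool n) →
           ∑[ i < n ] ∑[ j < n ] ⟦ a i xor a j ⟧
           ≈ count a * count (not ∘ a) + count (not ∘ a) * count a
  ∑∑-xor {n} a = begin
    ∑[ i < n ] ∑[ j < n ] ⟦ a i xor a j ⟧
      ≈⟨ sum-cong-≋ (λ i → row (a i)) ⟩
    ∑[ i < n ] (⟦ a i ⟧ * t + ⟦ not (a i) ⟧ * s)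
      ≈⟨ ∑-distrib-+ (λ i → ⟦ a i ⟧ * t) (λ i → ⟦ not (a i) ⟧ * s) ⟩
    ∑[ i < n ] (⟦ a i ⟧ * t) + ∑[ i < n ] (⟦ not (a i) ⟧ * s)
      ≈⟨ sym (+-cong (*-distribʳ-sum t (⟦_⟧ ∘ a)) (*-distribʳ-sum s (⟦_⟧ ∘ not ∘ a))) ⟩
    s * t + t * s ∎
    where
    s = count a
    t = count (not ∘ a)
    row : ∀ x → ∑[ j < n ] ⟦ x xor a j ⟧ ≈ ⟦ x ⟧ * t + ⟦ not x ⟧ * s
    row true  = sym (trans (+-cong (*-identityˡ t) (zeroˡ s)) (+-identityʳ t))
    row false = sym (trans (+-cong (zeroˡ t) (*-identityˡ s)) (+-identityˡ s))

module CutWeight where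

  open import Data.Nat using (_+_; _*_; _≤_; _<_)
  open import Data.Nat.Properties
  open import Data.Nat.DivMod using (m<n⇒m%n≡m; m≤n⇒[n∸m]%m≡n%m; %-distribˡ-+; m%n%n≡m%n; m%n<n)
  open import Data.Nat.Tactic.RingSolver using (solve-∀)
  open import Relation.Binary.PropositionalEquality using (trans; sym)

  open import Algebra.Properties.Semiring.Sum +-*-semiring using (sum)

  cutWeight : ℕ → ℕ → ℕ
  cutWeight k r = r * (k ∸ r)

  cutWeight-+ : ∀ r r′ → cutWeight (r + r′) r ≡ r * r′
  cutWeight-+ r r′ = cong (r *_) (m+n∸m≡n r r′)

  cutWeight-complement : ∀ {k r} → r ≤ k → cutWeight k (k ∸ r) ≡ cutWeight k r
  cutWeight-complement {k} {r} r≤k = trans (cong ((k ∸ r) *_) (m∸[m∸n]≡n r≤k)) (*-comm (k ∸ r) r)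

  cutWeight-split : ∀ a b c → let k = a + b + c in
                    cutWeight k (a + b) ≤ cutWeight k a + cutWeight k b
  cutWeight-split a b c = begin
    cutWeight (a + b + c) (a + b)
      ≡⟨ cutWeight-+ (a + b) c ⟩
    (a + b) * c
      ≤⟨ m≤m+n _ (2 * (a * b)) ⟩
    (a + b) * c + 2 * (a * b)
      ≡⟨ expand a b c ⟩
    a * (b + c) + b * (a + c)
      ≡⟨ cong₂ _+_ (cutWeight-+ a (b + c)) (cutWeight-+ b (a + c)) ⟨
    cutWeight (a + (b + c)) a + cutWeight (b + (a + c)) b
      ≡⟨ cong₂ (λ k k′ → cutWeight k a + cutWeight k′ b) (+-assoc a b c) (regroup a b c) ⟨
    cutWeight (a + b + c) a + cutWeight (a + b + c) b ∎
    where
    open ≤-Reasoning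
    expand : ∀ a b c → (a + b) * c + 2 * (a * b) ≡ a * (b + c) + b * (a + c)
    expand = solve-∀
    regroup : ∀ a b c → a + b + c ≡ b + (a + c)
    regroup = solve-∀

  cutWeight-subadditive : ∀ {k} a b → a + b ≤ k → cutWeight k (a + b) ≤ cutWeight k a + cutWeight k b
  cutWeight-subadditive {k} a b a+b≤k =
    subst (λ k → cutWeight k (a + b) ≤ cutWeight k a + cutWeight k b) (m+[n∸m]≡n a+b≤k)
          (cutWeight-split a b (k ∸ (a + b)))

  %-wrap : ∀ {k a b} .{{_ : NonZero k}} → a ≤ k → b < k → k ≤ a + b →
           (a + b) % k ≡ k ∸ ((k ∸ a) + (k ∸ b))
  %-wrap {k} {a} {b} a≤k b<k k≤a+b = begin
    (a + b) % k                ≡⟨ m≤n⇒[n∸m]%m≡n%m k≤a+b ⟨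
    (a + b ∸ k) % k            ≡⟨ m<n⇒m%n≡m (m<n+o⇒m∸n<o (a + b) k (+-mono-≤-< a≤k b<k)) ⟩
    a + b ∸ k                  ≡⟨ cong₂ _∸_ (+-comm a b) (sym (m+[n∸m]≡n (<⇒≤ b<k))) ⟩
    b + a ∸ (b + (k ∸ b))      ≡⟨ [m+n]∸[m+o]≡n∸o b a (k ∸ b) ⟩
    a ∸ (k ∸ b)                ≡⟨ cong (_∸ (k ∸ b)) (m∸[m∸n]≡n a≤k) ⟨
    k ∸ (k ∸ a) ∸ (k ∸ b)      ≡⟨ ∸-+-assoc k (k ∸ a) (k ∸ b) ⟩
    k ∸ ((k ∸ a) + (k ∸ b))    ∎
    where open ≡.≡-Reasoning

  cutWeight-%-+ : ∀ {k a b} .{{_ : NonZero k}} → a ≤ k → b < k →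
                  cutWeight k ((a + b) % k) ≤ cutWeight k a + cutWeight k b
  cutWeight-%-+ {k} {a} {b} a≤k b<k with a + b <? k
  ... | yes a+b<k = subst (λ r → cutWeight k r ≤ cutWeight k a + cutWeight k b)
                          (sym (m<n⇒m%n≡m a+b<k)) (cutWeight-subadditive a b (<⇒≤ a+b<k))
  ... | no a+b≮k = begin
    cutWeight k ((a + b) % k)        ≡⟨ cong (cutWeight k) (%-wrap a≤k b<k k≤a+b) ⟩
    cutWeight k (k ∸ (a′ + b′))      ≡⟨ cutWeight-complement a′+b′≤k ⟩
    cutWeight k (a′ + b′)            ≤⟨ cutWeight-subadditive a′ b′ a′+b′≤k ⟩
    cutWeight k a′ + cutWeight k b′  ≡⟨ cong₂ _+_ (cutWeight-complement a≤k)
                                                  (cutWeight-complement (<⇒≤ b<k)) ⟩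
    cutWeight k a + cutWeight k b    ∎
    where
    open ≤-Reasoning
    a′ = k ∸ a
    b′ = k ∸ b
    k≤a+b : k ≤ a + b
    k≤a+b = ≮⇒≥ a+b≮k
    a′+b′≤k : a′ + b′ ≤ k
    a′+b′≤k = begin
      a′ + b′ ≤⟨ +-monoʳ-≤ a′ (m≤n+o⇒m∸n≤o k b (subst (k ≤_) (+-comm a b) k≤a+b)) ⟩
      a′ + a  ≡⟨ m∸n+n≡m a≤k ⟩
      k       ∎

  cutWeight-%-∑ : ∀ {k n} .{{_ : NonZero k}} (s : Vector ℕ n) → (∀ B → s B ≤ k) →
                  cutWeight k (sum s % k) ≤ sum (λ B → cutWeight k (s B))
  cutWeight-%-∑ {k} {zero} s s≤k = ≤-reflexive (cong (cutWeight k) (m<n⇒m%n≡m (>-nonZero⁻¹ k)))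
  cutWeight-%-∑ {k} {suc n} s s≤k = begin
    cutWeight k ((s₀ + R) % k)
      ≡⟨ cong (cutWeight k) (%-absorb s₀ R) ⟩
    cutWeight k ((s₀ + R % k) % k)
      ≤⟨ cutWeight-%-+ (s≤k Fin.zero) (m%n<n R k) ⟩
    cutWeight k s₀ + cutWeight k (R % k)
      ≤⟨ +-monoʳ-≤ (cutWeight k s₀) (cutWeight-%-∑ (s ∘ Fin.suc) (λ B → s≤k (Fin.suc B))) ⟩
    cutWeight k s₀ + sum (λ B → cutWeight k (s (Fin.suc B))) ∎
    where
    open ≤-Reasoning
    s₀ = s Fin.zero
    R = sum (s ∘ Fin.suc)
    %-absorb : ∀ m n → (m + n) % k ≡ (m + n % k) % k
    %-absorb m n = trans (%-distribˡ-+ m n k)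
                     (sym (trans (%-distribˡ-+ m (n % k) k) (cong (λ x → (m % k + x) % k) (m%n%n≡m%n n k))))

module OrderedFieldProperties (F : OrderedField) where

  open OrderedField F

  commutativeRing : CommutativeRing 0ℓ 0ℓ
  commutativeRing = record { isCommutativeRing = isCommutativeRing }

  open CommutativeRing commutativeRing public
    using ( +-assoc; +-comm; +-identityˡ; +-identityʳ; -‿inverseˡ; -‿inverseʳ
          ; *-comm; *-identityˡ; *-identityʳ; zeroˡ; zeroʳ; distribˡ
          ; commutativeSemiring; semiring; ring; +-abelianGroup)
  open import Algebra.Properties.Ring ring using (-‿distribˡ-*; -‿distribʳ-*)
  open import Algebra.Properties.AbelianGroup +-abelianGroup using (⁻¹-anti-homo‿-; ⁻¹-involutive)
  open import Algebra.Properties.Semiring.Mult semiring using (×1-homo-*; ×-assoc-*; ×-congʳ; ×-homo-+)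
    renaming (_×_ to _×ₙ_)
  open import Algebra.Properties.Semiring.Sum semiring using (sum; sum-replicate; sum-replicate-zero)
  import Algebra.Properties.Semiring.Sum ℕ.+-*-semiring as ℕ∑
  open IsTotalOrder isTotalOrder public using (total; antisym)
    renaming (refl to ≤-refl; trans to ≤-trans; reflexive to ≤-reflexive)

  poset : Poset 0ℓ 0ℓ 0ℓ
  poset = record { isPartialOrder = IsTotalOrder.isPartialOrder isTotalOrder }

  module ≤-Reasoning = Relation.Binary.Reasoning.PartialOrder poset

  open ≤-Reasoning

  +-monoʳ-≤ : ∀ {x y} z → x ≤ y → z + x ≤ z + y
  +-monoʳ-≤ {x} {y} z x≤y = subst₂ _≤_ (+-comm x z) (+-comm y z) (+-monoˡ-≤ z x≤y)

  +-mono-≤ : ∀ {x y u v} → x ≤ y → u ≤ v → x + u ≤ y + v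
  +-mono-≤ {y = y} {u} x≤y u≤v = ≤-trans (+-monoˡ-≤ u x≤y) (+-monoʳ-≤ y u≤v)

  +-cancelʳ-≤ : ∀ {x y} z → x + z ≤ y + z → x ≤ y
  +-cancelʳ-≤ {x} {y} z le = subst₂ _≤_ (cancel x) (cancel y) (+-monoˡ-≤ (- z) le)
    where
    cancel : ∀ w → w + z + - z ≡ w
    cancel w = ≡.trans (+-assoc w z (- z)) (≡.trans (cong (w +_) (-‿inverseʳ z)) (+-identityʳ w))

  x≤y⇒0≤y-x : ∀ {x y} → x ≤ y → 0# ≤ y - x
  x≤y⇒0≤y-x {x} {y} x≤y = subst (_≤ y - x) (-‿inverseʳ x) (+-monoˡ-≤ (- x) x≤y)

  x≤y+x : ∀ {x y} → 0# ≤ y → x ≤ y + x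
  x≤y+x {x} {y} 0≤y = subst (_≤ y + x) (+-identityˡ x) (+-monoˡ-≤ x 0≤y)

  x≤x+y : ∀ {x y} → 0# ≤ y → x ≤ x + y
  x≤x+y {x} {y} 0≤y = subst (_≤ x + y) (+-identityʳ x) (+-monoʳ-≤ x 0≤y)

  0≤+ : ∀ {x y} → 0# ≤ x → 0# ≤ y → 0# ≤ x + y
  0≤+ 0≤x 0≤y = ≤-trans 0≤x (x≤x+y 0≤y)

  x+x≤y+y⇒x≤y : ∀ {x y} → x + x ≤ y + y → x ≤ y
  x+x≤y+y⇒x≤y {x} {y} le with total x y
  ... | inj₁ x≤y = x≤y
  ... | inj₂ y≤x = +-cancelʳ-≤ x (≤-trans le (+-monoʳ-≤ y y≤x))

  0≤1 : 0# ≤ 1#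
  0≤1 with total 0# 1#
  ... | inj₁ 0≤1 = 0≤1
  ... | inj₂ 1≤0 = subst (0# ≤_) -1*-1≡1 (0≤* 0≤-1 0≤-1)
    where
    0≤-1 : 0# ≤ - 1#
    0≤-1 = subst₂ _≤_ (-‿inverseʳ 1#) (+-identityˡ (- 1#)) (+-monoˡ-≤ (- 1#) 1≤0)
    -1*-1≡1 : - 1# * - 1# ≡ 1#
    -1*-1≡1 = ≡.trans (≡.sym (-‿distribˡ-* 1# (- 1#)))
                      (≡.trans (cong -_ (*-identityˡ (- 1#))) (⁻¹-involutive 1#))

  *-monoˡ-≤-nonNeg : ∀ {x y} z → 0# ≤ z → x ≤ y → z * x ≤ z * y
  *-monoˡ-≤-nonNeg {x} {y} z 0≤z x≤y = begin
    z * x                      ≤⟨ x≤y+x (0≤* 0≤z (x≤y⇒0≤y-x x≤y)) ⟩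
    z * (y - x) + z * x        ≡⟨ cong (_+ z * x) (distribˡ z y (- x)) ⟩
    z * y + z * - x + z * x    ≡⟨ cong (λ t → z * y + t + z * x) (-‿distribʳ-* z x) ⟨
    z * y + - (z * x) + z * x  ≡⟨ +-assoc (z * y) (- (z * x)) (z * x) ⟩
    z * y + (- (z * x) + z * x) ≡⟨ cong (z * y +_) (-‿inverseˡ (z * x)) ⟩
    z * y + 0#                 ≡⟨ +-identityʳ (z * y) ⟩
    z * y                      ∎

  fromℕ≡×1 : ∀ n → fromℕ n ≡ n ×ₙ 1#
  fromℕ≡×1 zero    = ≡.refl
  fromℕ≡×1 (suc n) = cong (1# +_) (fromℕ≡×1 n)

  fromℕ-+ : ∀ a b → fromℕ (a ℕ.+ b) ≡ fromℕ a + fromℕ b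
  fromℕ-+ a b = ≡.trans (fromℕ≡×1 (a ℕ.+ b))
                  (≡.trans (×-homo-+ 1# a b) (≡.sym (cong₂ _+_ (fromℕ≡×1 a) (fromℕ≡×1 b))))

  fromℕ-* : ∀ a b → fromℕ (a ℕ.* b) ≡ fromℕ a * fromℕ b
  fromℕ-* a b = ≡.trans (fromℕ≡×1 (a ℕ.* b))
                  (≡.trans (×1-homo-* a b) (≡.sym (cong₂ _*_ (fromℕ≡×1 a) (fromℕ≡×1 b))))

  0≤fromℕ : ∀ n → 0# ≤ fromℕ n
  0≤fromℕ zero    = ≤-refl
  0≤fromℕ (suc n) = ≤-trans 0≤1 (x≤x+y (0≤fromℕ n))

  fromℕ-mono-≤ : ∀ {a b} → a ℕ.≤ b → fromℕ a ≤ fromℕ b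
  fromℕ-mono-≤ {a} {b} a≤b = begin
    fromℕ a                    ≤⟨ x≤y+x (0≤fromℕ (b ℕ.∸ a)) ⟩
    fromℕ (b ℕ.∸ a) + fromℕ a  ≡⟨ fromℕ-+ (b ℕ.∸ a) a ⟨
    fromℕ (b ℕ.∸ a ℕ.+ a)      ≡⟨ cong fromℕ (ℕ.m∸n+n≡m a≤b) ⟩
    fromℕ b                    ∎

  1≤fromℕ : ∀ {n} → 1 ℕ.≤ n → 1# ≤ fromℕ n
  1≤fromℕ {n} 1≤n = subst (_≤ fromℕ n) (+-identityʳ 1#) (fromℕ-mono-≤ 1≤n)

  x≤fromℕ*x : ∀ {n x} → 1 ℕ.≤ n → 0# ≤ x → x ≤ fromℕ n * x
  x≤fromℕ*x {n} {x} 1≤n 0≤x = begin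
    x              ≡⟨ *-identityˡ x ⟨
    1# * x         ≡⟨ *-comm 1# x ⟩
    x * 1#         ≤⟨ *-monoˡ-≤-nonNeg x 0≤x (1≤fromℕ 1≤n) ⟩
    x * fromℕ n    ≡⟨ *-comm x (fromℕ n) ⟩
    fromℕ n * x    ∎

  0≤inv : ∀ {x} → 1# ≤ x → 0# ≤ inv x
  0≤inv {x} 1≤x with total 0# (inv x)
  ... | inj₁ 0≤x⁻¹ = 0≤x⁻¹
  ... | inj₂ x⁻¹≤0 = contradiction (antisym 0≤1 1≤0) 0≢1
    where
    x≢0 : x ≢ 0#
    x≢0 x≡0 = 0≢1 (antisym 0≤1 (subst (1# ≤_) x≡0 1≤x))
    0≤-x⁻¹*x : 0# ≤ - inv x * x
    0≤-x⁻¹*x = 0≤* (subst₂ _≤_ (-‿inverseʳ (inv x)) (+-identityˡ (- inv x))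
                              (+-monoˡ-≤ (- inv x) x⁻¹≤0))
                   (≤-trans 0≤1 1≤x)
    1≤0 : 1# ≤ 0#
    1≤0 = begin
      1#                   ≡⟨ +-identityˡ 1# ⟨
      0# + 1#              ≤⟨ +-monoˡ-≤ 1# 0≤-x⁻¹*x ⟩
      - inv x * x + 1#     ≡⟨ cong (_+ 1#) (≡.trans (≡.sym (-‿distribˡ-* (inv x) x))
                                (cong -_ (≡.trans (*-comm (inv x) x) (inv-r x x≢0)))) ⟩
      - 1# + 1#            ≡⟨ -‿inverseˡ 1# ⟩
      0#                   ∎

  <+ε-irrefl : ∀ {y ε} → 0# < ε → ¬ (y + ε ≤ y)
  <+ε-irrefl {y} {ε} (0≤ε , 0≢ε) y+ε≤y = 0≢ε (antisym 0≤ε (+-cancelʳ-≤ y ε≤0))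
    where
    ε≤0 : ε + y ≤ 0# + y
    ε≤0 = subst₂ _≤_ (+-comm y ε) (≡.sym (+-identityˡ y)) y+ε≤y

  ¬¬≤⇒<+ε : ∀ {x y ε} → ¬ ¬ (x ≤ y) → 0# < ε → x < y + ε
  ¬¬≤⇒<+ε {x} {y} {ε} ¬¬x≤y 0<ε = x≤y+ε , x≢y+ε
    where
    x≤y+ε : x ≤ y + ε
    x≤y+ε with total x (y + ε)
    ... | inj₁ x≤y+ε = x≤y+ε
    ... | inj₂ y+ε≤x = ⊥-elim (¬¬x≤y (λ x≤y → <+ε-irrefl 0<ε (≤-trans y+ε≤x x≤y)))
    x≢y+ε : x ≢ y + ε
    x≢y+ε x≡y+ε = ¬¬x≤y (λ x≤y → <+ε-irrefl 0<ε (subst (_≤ y) x≡y+ε x≤y))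

  max-≤ˡ : ∀ x y → x ≤ max x y
  max-≤ˡ x y with total x y
  ... | inj₁ x≤y = x≤y
  ... | inj₂ _   = ≤-refl

  max-≤ʳ : ∀ x y → y ≤ max x y
  max-≤ʳ x y with total x y
  ... | inj₁ _   = ≤-refl
  ... | inj₂ y≤x = y≤x

  max-lub : ∀ {x y z} → x ≤ z → y ≤ z → max x y ≤ z
  max-lub {x} {y} x≤z y≤z with total x y
  ... | inj₁ _ = y≤z
  ... | inj₂ _ = x≤z

  maxList-≥ : ∀ {x} xs → x ∈ xs → x ≤ maxList xs
  maxList-≥ (y ∷ [])     (here ≡.refl) = ≤-refl
  maxList-≥ (y ∷ z ∷ zs) (here ≡.refl) = max-≤ˡ y (maxList (z ∷ zs))
  maxList-≥ (y ∷ z ∷ zs) (there x∈zs)  = ≤-trans (maxList-≥ (z ∷ zs) x∈zs) (max-≤ʳ y _)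

  maxList-allFin-≥ : ∀ {n} (f : Vector Carrier n) i → f i ≤ maxList (map f (allFin n))
  maxList-allFin-≥ f i = maxList-≥ _ (∈-map⁺ f (∈-allFin i))

  0≤abs : ∀ x → 0# ≤ abs x
  0≤abs x with total 0# x
  ... | inj₁ 0≤x = ≤-trans 0≤x (max-≤ˡ x (- x))
  ... | inj₂ x≤0 = ≤-trans (subst₂ _≤_ (-‿inverseʳ x) (+-identityˡ (- x)) (+-monoˡ-≤ (- x) x≤0))
                           (max-≤ʳ x (- x))

  abs-diff-≤ : ∀ x y → abs (x - y) ≤ abs (y - x)
  abs-diff-≤ x y = max-lub (subst (_≤ abs (y - x)) (⁻¹-anti-homo‿- y x) (max-≤ʳ (y - x) _))
                           (subst (_≤ abs (y - x)) (≡.sym (⁻¹-anti-homo‿- x y)) (max-≤ˡ (y - x) _))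

  abs-diff-comm : ∀ x y → abs (x - y) ≡ abs (y - x)
  abs-diff-comm x y = antisym (abs-diff-≤ x y) (abs-diff-≤ y x)

  abs-diff-≤-gaps : ∀ {x y M} → x ≤ M → y ≤ M → abs (x - y) ≤ (M - x) + (M - y)
  abs-diff-≤-gaps {x} {y} {M} x≤M y≤M =
    max-lub (bound x≤M y≤M)
            (subst₂ _≤_ (≡.sym (⁻¹-anti-homo‿- x y)) (+-comm (M - y) (M - x)) (bound y≤M x≤M))
    where
    bound : ∀ {x y} → x ≤ M → y ≤ M → x - y ≤ (M - x) + (M - y)
    bound {x} {y} x≤M y≤M = ≤-trans (+-monoˡ-≤ (- y) x≤M) (x≤y+x (x≤y⇒0≤y-x x≤M))

  ∑-mono-≤ : ∀ {n} {f g : Vector Carrier n} → (∀ i → f i ≤ g i) → sum f ≤ sum g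
  ∑-mono-≤ {zero}  f≤g = ≤-refl
  ∑-mono-≤ {suc n} f≤g = +-mono-≤ (f≤g Fin.zero) (∑-mono-≤ (f≤g ∘ Fin.suc))

  ∑-nonNeg : ∀ {n} {f : Vector Carrier n} → (∀ i → 0# ≤ f i) → 0# ≤ sum f
  ∑-nonNeg {n} {f} 0≤f = subst (_≤ sum f) (sum-replicate-zero n) (∑-mono-≤ 0≤f)

  ≤-∑ : ∀ {n} {f : Vector Carrier n} → (∀ i → 0# ≤ f i) → ∀ i → f i ≤ sum f
  ≤-∑ {suc n} 0≤f Fin.zero    = x≤x+y (∑-nonNeg (0≤f ∘ Fin.suc))
  ≤-∑ {suc n} 0≤f (Fin.suc i) = ≤-trans (≤-∑ (0≤f ∘ Fin.suc) i) (x≤y+x (0≤f Fin.zero))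

  sumFin≡sum : ∀ n (f : Vector Carrier n) → sumFin n f ≡ sum f
  sumFin≡sum zero    f = ≡.refl
  sumFin≡sum (suc n) f = cong (f Fin.zero +_) (sumFin≡sum n (f ∘ Fin.suc))

  fromℕ-∑ : ∀ {n} (f : Vector ℕ n) → fromℕ (ℕ∑.sum f) ≡ sum (fromℕ ∘ f)
  fromℕ-∑ {zero}  f = ≡.refl
  fromℕ-∑ {suc n} f =
    ≡.trans (fromℕ-+ (f Fin.zero) _) (cong (fromℕ (f Fin.zero) +_) (fromℕ-∑ (f ∘ Fin.suc)))

  ∑-const : ∀ n x → sum {n} (λ _ → x) ≡ fromℕ n * x
  ∑-const n x = begin-equality
    sum {n} (λ _ → x)   ≡⟨ sum-replicate n ⟩
    n ×ₙ x              ≡⟨ ×-congʳ n (*-identityˡ x) ⟨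
    n ×ₙ (1# * x)       ≡⟨ ×-assoc-* n 1# x ⟨
    (n ×ₙ 1#) * x       ≡⟨ cong (_* x) (fromℕ≡×1 n) ⟨
    fromℕ n * x        ∎

module MatchingCut {m n k} .{{_ : NonZero k}} (φ : (Fin n × Fin k) ↔ Fin m) where

  open Inverse φ using (to)
  open FiniteSums ℕ.+-*-commutativeSemiring
  open CutWeight using (cutWeight; cutWeight-%-∑)
  open import Data.Nat using (_+_; _*_; _≤_)

  cutPairs : Vector Bool m → Fin m → Fin m → ℕ
  cutPairs a u v = if sameBlock φ u v then ⟦ a u xor a v ⟧ else 0

  sides : Vector Bool m → Fin n → Vector Bool k
  sides a B i = a (to (B , i))

  count+count-not : ∀ {n} (a : Vector Bool n) → count a + count (not ∘ a) ≡ n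
  count+count-not {zero}  a = ≡.refl
  count+count-not {suc n} a with a Fin.zero
  ... | true  = cong suc (count+count-not (a ∘ Fin.suc))
  ... | false = ≡.trans (ℕ.+-suc _ _) (cong suc (count+count-not (a ∘ Fin.suc)))

  ∣S∣≡count : ∀ {m} (S : Subset m) → ∣ S ∣ ≡ count (lookup S)
  ∣S∣≡count Vec.[]          = ≡.refl
  ∣S∣≡count (true Vec.∷ S)  = cong suc (∣S∣≡count S)
  ∣S∣≡count (false Vec.∷ S) = ∣S∣≡count S

  ∑<-cutPairs : ∀ a → ∑< (cutPairs a) ≡ ∑[ B < n ] (count (sides a B) * count (not ∘ sides a B))
  ∑<-cutPairs a = halve (begin
    ∑< c + ∑< c
      ≡⟨ cong (∑< c +_) (ℕ.+-identityʳ (∑< c)) ⟨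
    ∑< c + (∑< c + 0)
      ≡⟨ cong (λ x → ∑< c + (∑< c + x)) diagonal ⟨
    ∑< c + (∑< c + ∑[ u < m ] c u u)
      ≡⟨ ∑∑-split-sym c c-sym ⟨
    ∑[ u < m ] ∑[ v < m ] c u v
      ≡⟨ ∑∑-sameBlock φ (λ u v → ⟦ a u xor a v ⟧) ⟩
    ∑[ B < n ] ∑[ i < k ] ∑[ j < k ] ⟦ sides a B i xor sides a B j ⟧
      ≡⟨ sum-cong-≗ (λ B → ≡.trans (∑∑-xor (sides a B)) (cong (s B * t B +_) (ℕ.*-comm (t B) (s B)))) ⟩
    ∑[ B < n ] (s B * t B + s B * t B)
      ≡⟨ ∑-distrib-+ (λ B → s B * t B) (λ B → s B * t B) ⟩
    X + X ∎)
    where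
    open ≡.≡-Reasoning
    c = cutPairs a
    s t : Fin n → ℕ
    s B = count (sides a B)
    t B = count (not ∘ sides a B)
    X = ∑[ B < n ] (s B * t B)
    c-sym : ∀ u v → c v u ≡ c u v
    c-sym u v = cong₂ (λ b x → if b then ⟦ x ⟧ else 0) (sameBlock-sym φ v u) (xor-comm (a v) (a u))
    diagonal : ∑[ u < m ] c u u ≡ 0
    diagonal = ≡.trans (sum-cong-≗ (λ u → ≡.cong₂ (λ b x → if b then ⟦ x ⟧ else 0)
                          (sameBlock-refl φ u) (xor-same (a u))))
                        (sum-replicate-zero m)
    halve : ∀ {x y} → x + x ≡ y + y → x ≡ y
    halve {x} {y} x+x≡y+y =
      ≡.trans (ℕ.n≡⌊n+n/2⌋ x) (≡.trans (cong ℕ.⌊_/2⌋ x+x≡y+y) (≡.sym (ℕ.n≡⌊n+n/2⌋ y)))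

  cutWeight-≤-∑<-cutPairs : ∀ (S : Subset m) → cutWeight k (∣ S ∣ % k) ≤ ∑< (cutPairs (lookup S))
  cutWeight-≤-∑<-cutPairs S = begin
    cutWeight k (∣ S ∣ % k)
      ≡⟨ cong (λ N → cutWeight k (N % k)) (≡.trans (∣S∣≡count S) (∑-blocks φ (⟦_⟧ ∘ lookup S))) ⟩
    cutWeight k ((∑[ B < n ] s B) % k)
      ≤⟨ cutWeight-%-∑ s (λ B → subst (s B ≤_) (s+t≡k B) (ℕ.m≤m+n (s B) (t B))) ⟩
    ∑[ B < n ] cutWeight k (s B)
      ≡⟨ sum-cong-≗ (λ B → cong (s B *_) (k∸s≡t B)) ⟩
    ∑[ B < n ] (s B * t B)
      ≡⟨ ∑<-cutPairs (lookup S) ⟨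
    ∑< (cutPairs (lookup S)) ∎
    where
    open ℕ.≤-Reasoning
    s t : Fin n → ℕ
    s B = count (sides (lookup S) B)
    t B = count (not ∘ sides (lookup S) B)
    s+t≡k : ∀ B → s B + t B ≡ k
    s+t≡k B = count+count-not (sides (lookup S) B)
    k∸s≡t : ∀ B → k ∸ s B ≡ t B
    k∸s≡t B = ≡.trans (cong (_∸ s B) (≡.sym (s+t≡k B))) (ℕ.m+n∸m≡n (s B) (t B))

module MatchingBounds (F : OrderedField) {χ : Set} (k γ : ℕ) .{{_ : NonZero k}} (1≤γ : 1 ℕ.≤ γ)
                      (dH : (Fin k → χ) → OrderedField.Carrier F) (isH : HMetric.IsHMetric F k γ dH)
                      (m : ℕ) (atime : Fin m → OrderedField.Carrier F) (pos : Fin m → χ) where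

  open OrderedField F
  open OrderedFieldProperties F
  open HMetric F {χ} k using (_⊆elem_)
  open HMetric.IsHMetric isH
  open MPMD F k γ dH m atime pos
  open FiniteSums commutativeSemiring
    using (sum; sum-syntax; sum-cong-≗; ∑-distrib-+; ⟦_⟧; *-⟦⟧; ∑<; ∑∑-split-sym; ∑∑-sameBlock)
  module ℕ∑ = FiniteSums ℕ.+-*-commutativeSemiring
  open import Algebra.Solver.Ring.NaturalCoefficients.Default commutativeSemiring
    using (solve; _:+_; _:*_; _:=_)
  open ≤-Reasoning

  -- Inclusion elem(q) ⊆ elem(p) is not decidable for an arbitrary χ, so the case split between
  -- proper and equal inclusion, and with it this bound, only holds under double negation.
  dH-≤-γ*dH : ∀ {p q} → p ⊆elem q → ¬ ¬ (dH p ≤ fromℕ γ * dH q)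
  dH-≤-γ*dH {p} {q} p⊆q ¬bound =
    ¬bound (≤-trans (mono-proper p q p⊆q q⊈p) (x≤fromℕ*x 1≤γ (nonneg q)))
    where
    q⊈p : ¬ (q ⊆elem p)
    q⊈p q⊆p = ¬bound (mono-equal p q p⊆q q⊆p)

  firstThenRest-⊆ : ∀ (p : Fin k → χ) i j → firstThenRest (p i) (p j) ⊆elem p
  firstThenRest-⊆ p i j x (l , pₗ≡x) with toℕ l ≡ᵇ 0
  ... | true  = i , pₗ≡x
  ... | false = j , pₗ≡x

  d-≤-2γ*dH : ∀ (p : Fin k → χ) i j → ¬ ¬ (d (p i) (p j) ≤ fromℕ γ * dH p + fromℕ γ * dH p)
  d-≤-2γ*dH p i j ¬bound =
    dH-≤-γ*dH (firstThenRest-⊆ p i j) λ ≤₁ →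
    dH-≤-γ*dH (firstThenRest-⊆ p j i) λ ≤₂ →
    ¬bound (+-mono-≤ ≤₁ ≤₂)

  0≤⟦⟧ : ∀ b → 0# ≤ ⟦ b ⟧
  0≤⟦⟧ true  = 0≤1
  0≤⟦⟧ false = ≤-refl

  0≤edgeCost : ∀ u v → 0# ≤ edgeCost u v
  0≤edgeCost u v = 0≤+ (0≤+ (nonneg _) (nonneg _)) (0≤abs _)

  edgeCost-comm : ∀ u v → edgeCost u v ≡ edgeCost v u
  edgeCost-comm u v = cong₂ _+_ (+-comm _ _) (abs-diff-comm (atime u) (atime v))

  sumE≡∑< : ∀ g → sumE g ≡ ∑< g
  sumE≡∑< g = ≡.trans (sumFin≡sum m (λ u → sumFin m (ordered u)))
                      (sum-cong-≗ (λ u → sumFin≡sum m (ordered u)))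
    where
    ordered : Fin m → Fin m → Carrier
    ordered u v = if toℕ u <ᵇ toℕ v then g u v else 0#

  γk² : Carrier
  γk² = fromℕ (γ ℕ.* k ℕ.* k)

  1≤γk² : 1# ≤ γk²
  1≤γk² = 1≤fromℕ (ℕ.*-mono-≤ (ℕ.*-mono-≤ 1≤γ 1≤k) 1≤k)
    where 1≤k = >-nonZero⁻¹ k

  inv[γk²]*γk²≡1 : inv γk² * γk² ≡ 1#
  inv[γk²]*γk²≡1 = ≡.trans (*-comm (inv γk²) γk²) (inv-r γk² γk²≢0)
    where
    γk²≢0 : γk² ≢ 0#
    γk²≢0 γk²≡0 = 0≢1 (antisym 0≤1 (subst (1# ≤_) γk²≡0 1≤γk²))

  ∑∑-cancel-γk² : ∀ y → ∑[ i < k ] ∑[ j < k ] (inv γk² * (fromℕ γ * y)) ≡ y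
  ∑∑-cancel-γk² y = begin-equality
    ∑[ i < k ] ∑[ j < k ] (inv γk² * (fromℕ γ * y))
      ≡⟨ ≡.trans (sum-cong-≗ {k} {λ _ → ∑[ j < k ] x} (λ _ → ∑-const k x))
                 (∑-const k (fromℕ k * x)) ⟩
    fromℕ k * (fromℕ k * (inv γk² * (fromℕ γ * y)))
      ≡⟨ solve 4 (λ κ c g y → κ :* (κ :* (c :* (g :* y))) := (c :* (g :* κ :* κ)) :* y) ≡.refl
               (fromℕ k) (inv γk²) (fromℕ γ) y ⟩
    (inv γk² * (fromℕ γ * fromℕ k * fromℕ k)) * y
      ≡⟨ cong (λ x → (inv γk² * x) * y)
              (≡.trans (fromℕ-* (γ ℕ.* k) k) (cong (_* fromℕ k) (fromℕ-* γ k))) ⟨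
    (inv γk² * γk²) * y
      ≡⟨ ≡.trans (cong (_* y) inv[γk²]*γk²≡1) (*-identityˡ y) ⟩
    y ∎
    where x = inv γk² * (fromℕ γ * y)

  module _ {n} (φ : PerfectMatching m k n) where

    open Inverse φ using (to)
    open MatchingCut φ using (cutPairs; cutWeight-≤-∑<-cutPairs)

    sumδ-indicator : ∀ S → sumδ S (indicator φ) ≡ fromℕ (ℕ∑.∑< (cutPairs (lookup S)))
    sumδ-indicator S = begin-equality
      sumδ S (indicator φ)
        ≡⟨ sumE≡∑< _ ⟩
      ∑< (λ u v → if lookup S u xor lookup S v then indicator φ u v else 0#)
        ≡⟨ sum-cong-≗ (λ u → sum-cong-≗ (λ v →
             fromℕ-if (toℕ u <ᵇ toℕ v) (lookup S u xor lookup S v) (sameBlock φ u v))) ⟨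
      sum (λ u → sum (λ v → fromℕ (cut< u v)))
        ≡⟨ ≡.trans (fromℕ-∑ (λ u → ℕ∑.sum (cut< u)))
                   (sum-cong-≗ (λ u → fromℕ-∑ (cut< u))) ⟨
      fromℕ (ℕ∑.∑< (cutPairs (lookup S))) ∎
      where
      cut< : Fin m → Fin m → ℕ
      cut< u v = if toℕ u <ᵇ toℕ v then cutPairs (lookup S) u v else 0
      fromℕ-if : ∀ l x s → fromℕ (if l then (if s then ℕ∑.⟦ x ⟧ else 0) else 0)
                           ≡ (if l then (if x then ⟦ s ⟧ else 0#) else 0#)
      fromℕ-if false _     _     = ≡.refl
      fromℕ-if true  false false = ≡.refl
      fromℕ-if true  false true  = ≡.refl
      fromℕ-if true  true  false = ≡.refl
      fromℕ-if true  true  true  = +-identityʳ 1#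

    feasible : Feasible (indicator φ)
    feasible = cut-constraint , λ u v _ → 0≤⟦⟧ (sameBlock φ u v)
      where
      cut-constraint : ∀ S → fromℕ (sur S ℕ.* (k ∸ sur S)) ≤ sumδ S (indicator φ)
      cut-constraint S =
        subst (_ ≤_) (≡.sym (sumδ-indicator S)) (fromℕ-mono-≤ (cutWeight-≤-∑<-cutPairs S))

    positions : Fin n → Fin k → χ
    positions B i = pos (to (B , i))

    waitingTime : Fin n → Fin k → Carrier
    waitingTime B i = maxList (map (λ j → atime (to (B , j))) (allFin k)) - atime (to (B , i))

    DistanceBound : Set
    DistanceBound = ∀ B i j → d (positions B i) (positions B j)
                              ≤ fromℕ γ * dH (positions B) + fromℕ γ * dH (positions B)

    ¬¬distanceBound : ¬ ¬ DistanceBound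
    ¬¬distanceBound = ∀-¬¬ λ B → ∀-¬¬ λ i → ∀-¬¬ λ j → d-≤-2γ*dH (positions B) i j
      where ∀-¬¬ = sequence (RawMonad.rawApplicative ¬¬-Monad)

    edgeCost-≤-blockCost : DistanceBound → ∀ B i j →
                           edgeCost (to (B , i)) (to (B , j)) ≤ fromℕ γ * (blockCost φ B + blockCost φ B)
    edgeCost-≤-blockCost bound B i j = begin
      d (positions B i) (positions B j) + abs (atime (to (B , i)) - atime (to (B , j)))
        ≤⟨ +-mono-≤ (bound B i j)
                    (≤-trans (abs-diff-≤-gaps (latest i) (latest j)) (+-mono-≤ (≤-T i) (≤-T j))) ⟩
      (γ′ * D + γ′ * D) + (T + T)
        ≤⟨ +-monoʳ-≤ (γ′ * D + γ′ * D) (+-mono-≤ T≤γ′T T≤γ′T) ⟩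
      (γ′ * D + γ′ * D) + (γ′ * T + γ′ * T)
        ≡⟨ solve 3 (λ g D T → (g :* D :+ g :* D) :+ (g :* T :+ g :* T) := g :* ((D :+ T) :+ (D :+ T)))
                   ≡.refl γ′ D T ⟩
      γ′ * ((D + T) + (D + T))
        ≡⟨ cong (λ x → γ′ * ((D + x) + (D + x))) (sumFin≡sum k (waitingTime B)) ⟨
      γ′ * (blockCost φ B + blockCost φ B) ∎
      where
      γ′ = fromℕ γ
      D = dH (positions B)
      T = sum (waitingTime B)
      latest : ∀ i → atime (to (B , i)) ≤ maxList (map (λ j → atime (to (B , j))) (allFin k))
      latest = maxList-allFin-≥ (λ j → atime (to (B , j)))
      ≤-T : ∀ i → waitingTime B i ≤ T
      ≤-T = ≤-∑ (λ i → x≤y⇒0≤y-x (latest i))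
      T≤γ′T : T ≤ γ′ * T
      T≤γ′T = x≤fromℕ*x 1≤γ (∑-nonNeg (λ i → x≤y⇒0≤y-x (latest i)))

    objective-≤ : DistanceBound → objective (indicator φ) ≤ matchingCost φ
    objective-≤ bound = x+x≤y+y⇒x≤y (begin
      objective (indicator φ) + objective (indicator φ)
        ≡⟨ cong₂ _+_ (sumE≡∑< g) (sumE≡∑< g) ⟩
      ∑< g + ∑< g
        ≤⟨ +-monoʳ-≤ (∑< g) (x≤x+y (∑-nonNeg (λ u → 0≤g u u))) ⟩
      ∑< g + (∑< g + ∑[ u < m ] g u u)
        ≡⟨ ∑∑-split-sym g g-sym ⟨
      ∑[ u < m ] ∑[ v < m ] g u v
        ≡⟨ sum-cong-≗ (λ u → sum-cong-≗ (λ v →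
             *-⟦⟧ (inv γk² * edgeCost u v) (sameBlock φ u v))) ⟩
      ∑[ u < m ] ∑[ v < m ] (if sameBlock φ u v then inv γk² * edgeCost u v else 0#)
        ≡⟨ ∑∑-sameBlock φ (λ u v → inv γk² * edgeCost u v) ⟩
      ∑[ B < n ] ∑[ i < k ] ∑[ j < k ] (inv γk² * edgeCost (to (B , i)) (to (B , j)))
        ≤⟨ ∑-mono-≤ (λ B → ∑-mono-≤ (λ i → ∑-mono-≤ (λ j →
             *-monoˡ-≤-nonNeg (inv γk²) (0≤inv 1≤γk²) (edgeCost-≤-blockCost bound B i j)))) ⟩
      ∑[ B < n ] ∑[ i < k ] ∑[ j < k ] (inv γk² * (fromℕ γ * (blockCost φ B + blockCost φ B)))
        ≡⟨ sum-cong-≗ (λ B → ∑∑-cancel-γk² (blockCost φ B + blockCost φ B)) ⟩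
      ∑[ B < n ] (blockCost φ B + blockCost φ B)
        ≡⟨ ∑-distrib-+ (blockCost φ) (blockCost φ) ⟩
      sum (blockCost φ) + sum (blockCost φ)
        ≡⟨ cong₂ _+_ (sumFin≡sum n (blockCost φ)) (sumFin≡sum n (blockCost φ)) ⟨
      matchingCost φ + matchingCost φ ∎)
      where
      g : Fin m → Fin m → Carrier
      g u v = inv γk² * edgeCost u v * indicator φ u v
      g-sym : ∀ u v → g v u ≡ g u v
      g-sym u v = cong₂ (λ e b → inv γk² * e * ⟦ b ⟧) (edgeCost-comm v u) (sameBlock-sym φ v u)
      0≤g : ∀ u v → 0# ≤ g u v
      0≤g u v = 0≤* (0≤* (0≤inv 1≤γk²) (0≤edgeCost u v)) (0≤⟦⟧ (sameBlock φ u v))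

    lpValue : LPValue≤ (matchingCost φ)
    lpValue ε 0<ε = indicator φ , feasible , ¬¬≤⇒<+ε (¬¬-map objective-≤ ¬¬distanceBound) 0<ε

lemma2 : (F : OrderedField) {χ : Set} (k γ : ℕ) .{{_ : NonZero k}} → 2 ℕ.≤ k
         → 1 ℕ.≤ γ → γ ℕ.≤ k ∸ 1
         → (dH : (Fin k → χ) → OrderedField.Carrier F)
         → HMetric.IsHMetric F k γ dH
         → (m : ℕ) → k ∣ m
         → (atime : Fin m → OrderedField.Carrier F) → (pos : Fin m → χ)
         → (∀ u → OrderedField._≤_ F (OrderedField.0# F) (atime u))
         → (∀ (u v : Fin m) → u ≤ᶠ v → OrderedField._≤_ F (atime u) (atime v))
         → (∀ n (φ : PerfectMatching m k n)
              → MPMD.Feasible F k γ dH m atime pos (MPMD.indicator F k γ dH m atime pos φ))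
           × (∀ n (φ : PerfectMatching m k n)
              → MPMD.LPValue≤ F k γ dH m atime pos (MPMD.matchingCost F k γ dH m atime pos φ))
lemma2 F k γ _ 1≤γ _ dH isH m _ atime pos _ _ = (λ _ → feasible) , (λ _ → lpValue)
  where open MatchingBounds F k γ 1≤γ dH isH m atime pos
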